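{- Let $q$ be a prime power and $m_1,n_1,m_2,n_2\in\{1,\dots,q-1\}$. Suppose there exists an integer $k$ with $\gcd(k,q-1)=1$ such that $m_2\equiv km_1 \pmod{q-1}$ and $n_2\equiv kn_1\pmod{q-1}$. Then $D(q;m_1,n_1)\cong D(q;m_2,n_2)$.
   Context: $\mathbb{F}_q$ is the field with $q$ elements. For integers $1\le m,n\le q-1$, the monomial digraph $D(q;m,n)$ has vertex set $\mathbb{F}_q^2$, and $((x_1,x_2),(y_1,y_2))$ is an arc iff $x_2+y_2=x_1^m y_1^n$. $\cong$ denotes digraph isomorphism. -}

module Defs where

open import Level using (0ℓ)
open import Data.Nat using (ℕ; zero; suc)
open import Data.Fin using (Fin)
open import Data.Product using (_×_; _,_; Σ; ∃)
open import Relation.Binary.PropositionalEquality using (_≡_; _≢_)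
open import Relation.Nullary using (¬_)
open import Algebra.Structures using (IsCommutativeRing)
open import Function.Bundles using (_⤖_; _⇔_; Bijection)

record FiniteField (q : ℕ) : Set₁ where
  field
    Carrier   : Set
    _+_ _*_   : Carrier → Carrier → Carrier
    -_        : Carrier → Carrier
    0# 1#     : Carrier
    isCommutativeRing : IsCommutativeRing _≡_ _+_ _*_ -_ 0# 1#
    0≢1       : 0# ≢ 1#
    inverse   : ∀ x → x ≢ 0# → Σ Carrier (λ y → x * y ≡ 1#)
    enum      : Carrier ⤖ Fin q

  infixl 6 _+_
  infixl 7 _*_

  _^_ : Carrier → ℕ → Carrier
  x ^ zero  = 1#
  x ^ suc n = x * (x ^ n)

record Digraph : Set₁ where
  field
    Vertex : Set
    Arc    : Vertex → Vertex → Set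

_≅_ : Digraph → Digraph → Set
G ≅ H = Σ (Digraph.Vertex G ⤖ Digraph.Vertex H) λ φ →
          ∀ u v → Digraph.Arc G u v ⇔ Digraph.Arc H (Bijection.to φ u) (Bijection.to φ v)

D : {q : ℕ} → FiniteField q → ℕ → ℕ → Digraph
D F m n = record
  { Vertex = Carrier × Carrier
  ; Arc    = λ { (x₁ , x₂) (y₁ , y₂) → x₂ + y₂ ≡ (x₁ ^ m) * (y₁ ^ n) }
  }
  where open FiniteField F

-- Let j be a positive inverse of k modulo q − 1. By Fermat's little theorem
-- x ^ (q − 1) = 1 for x ≠ 0, so positive exponents of field elements only
-- matter modulo q − 1. Hence x ↦ x ^ j is a permutation of F (inverted by a
-- positive representative of k), and (x ^ j) ^ m₂ = x ^ (j m₂) = x ^ m₁, and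
-- likewise for n. So (x₁ , x₂) ↦ (x₁ ^ j , x₂) turns the arc equation
-- x₂ + y₂ = x₁ ^ m₁ · y₁ ^ n₁ into x₂ + y₂ = (x₁ ^ j) ^ m₂ · (y₁ ^ j) ^ n₂.

module Submission where

open import Defs
open import Data.Nat using (ℕ; _≤_; _∸_; _^_)
open import Data.Nat.Primality using (Prime)
open import Data.Integer using (ℤ; +_; _-_; _*_)
open import Data.Integer.GCD using (gcd)
open import Data.Integer.Divisibility using (_∣_)
open import Data.Product using (Σ; _×_)
open import Relation.Binary.PropositionalEquality using (_≡_)

open import Data.Nat as ℕ using (zero; suc; s≤s; NonZero)
import Data.Nat.Properties as ℕ
open import Data.Nat.Divisibility as ℕ using ()
open import Data.Nat.DivMod as ℕ using ()
open import Data.Nat.GCD using (module Bézout)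
open import Data.Nat.Coprimality using (coprime-Bézout; gcd≡1⇒coprime)
open import Data.Integer as ℤ using (-[1+_]; _+_; -_; 1ℤ; _⊖_; _%ℕ_; _/ℕ_)
import Data.Integer.Properties as ℤ
open import Data.Integer.Divisibility.Signed
  using (divides; ∣ᵤ⇒∣; ∣⇒∣ᵤ; ∣m∣n⇒∣m+n; ∣m⇒∣-m; ∣m⇒∣m*n; ∣n⇒∣m*n)
  renaming (_∣_ to _∣ˢ_)
open import Data.Integer.DivMod using (a≡a%ℕn+[a/ℕn]*n)
open import Data.Integer.Tactic.RingSolver using (solve-∀)
open import Data.Fin as Fin using (Fin)
open import Data.Fin.Properties using (punchInᵢ≢i)
open import Data.Vec.Functional using (Vector)
open import Data.Product using (∃-syntax; ∃₂; _,_)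
open import Data.Sum using (inj₁; inj₂)
open import Data.Bool using (if_then_else_)
open import Algebra.Bundles using (CommutativeMonoid; CommutativeRing)
open import Algebra.Structures using (IsCommutativeRing)
open import Function using (_∘_; _↔_; Inverse; Bijection; mk↔ₛ′; mk⇔)
open import Function.Properties.Bijection using (⤖⇒↔)
open import Function.Properties.Inverse using (↔⇒⤖)
open import Function.Construct.Composition using (_↔-∘_)
open import Function.Construct.Identity using (↔-id)
open import Function.Construct.Symmetry using (↔-sym)
open import Data.Product.Function.NonDependent.Propositional using (_×-↔_)
open import Relation.Nullary using (does; yes; no)
open import Relation.Nullary.Decidable using (via-injection; dec-true; dec-false)
open import Relation.Binary.Bundles using (Setoid)
open import Relation.Binary.Definitions using (DecidableEquality)
open import Relation.Binary.Structures using (IsEquivalence)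
open import Relation.Binary.PropositionalEquality
  using (_≢_; refl; sym; trans; cong; cong₂; subst; module ≡-Reasoning)
import Relation.Binary.Reasoning.Setoid

infix 4 _≈_mod_

-- A record rather than a synonym for n ∣ a - b, so that a, b and n can be inferred.
record _≈_mod_ (a b n : ℤ) : Set where
  constructor mk≈
  field n∣a-b : n ∣ˢ a - b

module _ {n : ℤ} where

  mod-refl : ∀ {a} → a ≈ a mod n
  mod-refl {a} = mk≈ (divides (+ 0) (lemma a n))
    where
    lemma : ∀ a n → a - a ≡ + 0 * n
    lemma = solve-∀

  mod-sym : ∀ {a b} → a ≈ b mod n → b ≈ a mod n
  mod-sym {a} {b} (mk≈ n∣a-b) = mk≈ (subst (n ∣ˢ_) (lemma a b) (∣m⇒∣-m n∣a-b))
    where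
    lemma : ∀ a b → - (a - b) ≡ b - a
    lemma = solve-∀

  mod-trans : ∀ {a b c} → a ≈ b mod n → b ≈ c mod n → a ≈ c mod n
  mod-trans {a} {b} {c} (mk≈ n∣a-b) (mk≈ n∣b-c) = mk≈ (subst (n ∣ˢ_) (lemma a b c) (∣m∣n⇒∣m+n n∣a-b n∣b-c))
    where
    lemma : ∀ a b c → (a - b) + (b - c) ≡ a - c
    lemma = solve-∀

  mod-*-cong : ∀ {a b c d} → a ≈ b mod n → c ≈ d mod n → a * c ≈ b * d mod n
  mod-*-cong {a} {b} {c} {d} (mk≈ n∣a-b) (mk≈ n∣c-d) =
    mk≈ (subst (n ∣ˢ_) (lemma a b c d) (∣m∣n⇒∣m+n (∣m⇒∣m*n c n∣a-b) (∣n⇒∣m*n b n∣c-d)))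
    where
    lemma : ∀ a b c d → (a - b) * c + b * (c - d) ≡ a * c - b * d
    lemma = solve-∀

  mod-isEquivalence : IsEquivalence (λ a b → a ≈ b mod n)
  mod-isEquivalence = record { refl = mod-refl ; sym = mod-sym ; trans = mod-trans }

mod-setoid : ℤ → Setoid _ _
mod-setoid n = record { isEquivalence = mod-isEquivalence {n} }

pos-+-* : ∀ a b c → + (a ℕ.+ b ℕ.* c) ≡ + a + + b * + c
pos-+-* a b c = trans (ℤ.pos-+ a (b ℕ.* c)) (cong (λ t → + a + t) (ℤ.pos-* b c))

bézout⇒inverse-mod : ∀ {a n} → Bézout.Identity 1 a n → ∃[ u ] u * + a ≈ 1ℤ mod + n
bézout⇒inverse-mod {a} {n} (Bézout.+- x y 1+yn≡xa) = + x , mk≈ (divides (+ y) (begin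
  + x * + a - 1ℤ          ≡⟨ cong (_- 1ℤ) (ℤ.pos-* x a) ⟨
  + (x ℕ.* a) - 1ℤ        ≡⟨ cong (λ t → + t - 1ℤ) 1+yn≡xa ⟨
  + (1 ℕ.+ y ℕ.* n) - 1ℤ  ≡⟨ cong (_- 1ℤ) (pos-+-* 1 y n) ⟩
  1ℤ + + y * + n - 1ℤ     ≡⟨ lemma (+ y * + n) ⟩
  + y * + n               ∎))
  where
  open ≡-Reasoning
  lemma : ∀ t → 1ℤ + t - 1ℤ ≡ t
  lemma = solve-∀
bézout⇒inverse-mod {a} {n} (Bézout.-+ x y 1+xa≡yn) = - + x , mk≈ (divides (- + y) (begin
  - + x * + a - 1ℤ        ≡⟨ lemma (+ x) (+ a) ⟩
  - (1ℤ + + x * + a)      ≡⟨ cong -_ (pos-+-* 1 x a) ⟨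
  - + (1 ℕ.+ x ℕ.* a)     ≡⟨ cong (λ t → - + t) 1+xa≡yn ⟩
  - + (y ℕ.* n)           ≡⟨ cong -_ (ℤ.pos-* y n) ⟩
  - (+ y * + n)           ≡⟨ ℤ.neg-distribˡ-* (+ y) (+ n) ⟩
  - + y * + n             ∎))
  where
  open ≡-Reasoning
  lemma : ∀ x a → - x * a - 1ℤ ≡ - (1ℤ + x * a)
  lemma = solve-∀

coprime⇒inverse-mod : ∀ k n → gcd k (+ n) ≡ 1ℤ → ∃[ u ] u * k ≈ 1ℤ mod + n
coprime⇒inverse-mod k n k-coprime
  with bézout⇒inverse-mod {ℤ.∣ k ∣} {n} (coprime-Bézout (gcd≡1⇒coprime (ℤ.+-injective k-coprime)))
coprime⇒inverse-mod (+ _)      _ _ | u , u∣k∣≈1 = u , u∣k∣≈1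
coprime⇒inverse-mod -[1+ a ]   _ _ | u , u∣k∣≈1 = - u , subst (_≈ 1ℤ mod _) (lemma u (+ ℕ.suc a)) u∣k∣≈1
  where
  lemma : ∀ u b → u * b ≡ - u * - b
  lemma = solve-∀

module _ {n : ℕ} .{{_ : NonZero n}} where

  -- Shifted by n to be positive: exponents are only periodic from 1 on, as 0 ^ 0 = 1.
  positive-representative : ℤ → ℕ
  positive-representative z = z %ℕ n ℕ.+ n

  1≤positive-representative : ∀ z → 1 ≤ positive-representative z
  1≤positive-representative z = ℕ.≤-trans (ℕ.>-nonZero⁻¹ n) (ℕ.m≤n+m n (z %ℕ n))

  positive-representative-≈ : ∀ z → + positive-representative z ≈ z mod + n
  positive-representative-≈ z = mk≈ (divides (1ℤ - z /ℕ n) (begin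
    + (r ℕ.+ n) - z                  ≡⟨ cong₂ _-_ (ℤ.pos-+ r n) (a≡a%ℕn+[a/ℕn]*n z n) ⟩
    + r + + n - (+ r + z /ℕ n * + n) ≡⟨ lemma (+ r) (+ n) (z /ℕ n) ⟩
    (1ℤ - z /ℕ n) * + n              ∎))
    where
    open ≡-Reasoning
    r = z %ℕ n
    lemma : ∀ r n t → r + n - (r + t * n) ≡ (1ℤ - t) * n
    lemma = solve-∀

  ∣∸⇒%≡ : ∀ {a b} → a ≤ b → n ℕ.∣ b ℕ.∸ a → a ℕ.% n ≡ b ℕ.% n
  ∣∸⇒%≡ {a} {b} a≤b n∣b∸a = begin
    a ℕ.% n                  ≡⟨ ℕ.%-remove-+ʳ a n∣b∸a ⟨
    (a ℕ.+ (b ℕ.∸ a)) ℕ.% n  ≡⟨ cong (ℕ._% n) (ℕ.m+[n∸m]≡n a≤b) ⟩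
    b ℕ.% n                  ∎
    where open ≡-Reasoning

  ∣⊖∣⇒%≡ : ∀ a b → n ℕ.∣ ℤ.∣ a ⊖ b ∣ → a ℕ.% n ≡ b ℕ.% n
  ∣⊖∣⇒%≡ a b n∣a⊖b with ℕ.≤-total a b
  ... | inj₁ a≤b = ∣∸⇒%≡ a≤b (subst (n ℕ.∣_) (ℤ.∣⊖∣-≤ a≤b) n∣a⊖b)
  ... | inj₂ b≤a = sym (∣∸⇒%≡ b≤a (subst (n ℕ.∣_) (trans (ℤ.∣m⊖n∣≡∣n⊖m∣ a b) (ℤ.∣⊖∣-≤ b≤a)) n∣a⊖b))

  ≈mod⇒%≡ : ∀ {a b} → + a ≈ + b mod + n → a ℕ.% n ≡ b ℕ.% n
  ≈mod⇒%≡ {a} {b} (mk≈ n∣a-b) =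
    ∣⊖∣⇒%≡ a b (subst (n ℕ.∣_) (cong ℤ.∣_∣ (ℤ.[+m]-[+n]≡m⊖n a b)) (∣⇒∣ᵤ n∣a-b))

  exponent-inverse : ∀ k → gcd k (+ n) ≡ 1ℤ →
    ∃₂ λ j κ → 1 ≤ j × 1 ≤ κ × (j ℕ.* κ) ℕ.% n ≡ 1 ℕ.% n ×
      (∀ {a b} → + b ≈ k * + a mod + n → (j ℕ.* b) ℕ.% n ≡ a ℕ.% n)
  exponent-inverse k k-coprime with coprime⇒inverse-mod k n k-coprime
  ... | u , uk≈1 =
    j , κ , 1≤positive-representative u , 1≤positive-representative k ,
    ≈mod⇒%≡ jκ≈1 , λ b≈ka → ≈mod⇒%≡ (jb≈a b≈ka)
    where
    open Relation.Binary.Reasoning.Setoid (mod-setoid (+ n))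
    j = positive-representative u
    κ = positive-representative k
    j≈u : + j ≈ u mod + n
    j≈u = positive-representative-≈ u
    jκ≈1 : + (j ℕ.* κ) ≈ 1ℤ mod + n
    jκ≈1 = begin
      + (j ℕ.* κ)    ≡⟨ ℤ.pos-* j κ ⟩
      + j * + κ      ≈⟨ mod-*-cong j≈u (positive-representative-≈ k) ⟩
      u * k          ≈⟨ uk≈1 ⟩
      1ℤ             ∎
    jb≈a : ∀ {a b} → + b ≈ k * + a mod + n → + (j ℕ.* b) ≈ + a mod + n
    jb≈a {a} {b} b≈ka = begin
      + (j ℕ.* b)    ≡⟨ ℤ.pos-* j b ⟩
      + j * + b      ≈⟨ mod-*-cong j≈u b≈ka ⟩
      u * (k * + a)  ≡⟨ ℤ.*-assoc u k (+ a) ⟨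
      u * k * + a    ≈⟨ mod-*-cong uk≈1 mod-refl ⟩
      1ℤ * + a       ≡⟨ ℤ.*-identityˡ (+ a) ⟩
      + a            ∎

module Properties {q : ℕ} (F : FiniteField q) where

  open FiniteField F
    using (Carrier; 0#; 1#; 0≢1; inverse; enum; isCommutativeRing)
    renaming (_*_ to _·_; _^_ to _^ᶠ_)
  open IsCommutativeRing isCommutativeRing
    using (*-assoc; *-comm; *-identityˡ; *-identityʳ; zeroˡ; zeroʳ)

  _≟_ : DecidableEquality Carrier
  _≟_ = via-injection (Bijection.injection enum) Fin._≟_

  ^ᶠ-+ : ∀ x a b → x ^ᶠ (a ℕ.+ b) ≡ x ^ᶠ a · x ^ᶠ b
  ^ᶠ-+ x zero    b = sym (*-identityˡ _)
  ^ᶠ-+ x (suc a) b = trans (cong (x ·_) (^ᶠ-+ x a b)) (sym (*-assoc x _ _))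

  ^ᶠ-* : ∀ x a b → x ^ᶠ (a ℕ.* b) ≡ (x ^ᶠ a) ^ᶠ b
  ^ᶠ-* x a zero    = cong (x ^ᶠ_) (ℕ.*-zeroʳ a)
  ^ᶠ-* x a (suc b) = begin
    x ^ᶠ (a ℕ.* suc b)             ≡⟨ cong (x ^ᶠ_) (ℕ.*-suc a b) ⟩
    x ^ᶠ (a ℕ.+ a ℕ.* b)           ≡⟨ ^ᶠ-+ x a (a ℕ.* b) ⟩
    x ^ᶠ a · x ^ᶠ (a ℕ.* b)        ≡⟨ cong (x ^ᶠ a ·_) (^ᶠ-* x a b) ⟩
    x ^ᶠ a · (x ^ᶠ a) ^ᶠ b         ∎
    where open ≡-Reasoning

  ^ᶠ-identityʳ : ∀ x → x ^ᶠ 1 ≡ x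
  ^ᶠ-identityʳ = *-identityʳ

  1^ᶠ : ∀ a → 1# ^ᶠ a ≡ 1#
  1^ᶠ zero    = refl
  1^ᶠ (suc a) = trans (*-identityˡ _) (1^ᶠ a)

  ·-nonzero : ∀ {x y} → x ≢ 0# → y ≢ 0# → x · y ≢ 0#
  ·-nonzero {x} {y} x≢0 y≢0 xy≡0 with inverse x x≢0
  ... | x⁻¹ , xx⁻¹≡1 = y≢0 (begin
    y               ≡⟨ *-identityˡ y ⟨
    1# · y          ≡⟨ cong (_· y) (trans (sym xx⁻¹≡1) (*-comm x x⁻¹)) ⟩
    x⁻¹ · x · y     ≡⟨ *-assoc x⁻¹ x y ⟩
    x⁻¹ · (x · y)   ≡⟨ cong (x⁻¹ ·_) xy≡0 ⟩
    x⁻¹ · 0#        ≡⟨ zeroʳ x⁻¹ ⟩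
    0#              ∎)
    where open ≡-Reasoning

  ·-cancelʳ : ∀ {x y z} → z ≢ 0# → x · z ≡ y · z → x ≡ y
  ·-cancelʳ {x} {y} {z} z≢0 xz≡yz with inverse z z≢0
  ... | z⁻¹ , zz⁻¹≡1 = begin
    x               ≡⟨ divide x ⟨
    x · z · z⁻¹     ≡⟨ cong (_· z⁻¹) xz≡yz ⟩
    y · z · z⁻¹     ≡⟨ divide y ⟩
    y               ∎
    where
    open ≡-Reasoning
    divide : ∀ w → w · z · z⁻¹ ≡ w
    divide w = trans (*-assoc w z z⁻¹) (trans (cong (w ·_) zz⁻¹≡1) (*-identityʳ w))

  scale-↔ : ∀ {x} → x ≢ 0# → Carrier ↔ Carrier
  scale-↔ {x} x≢0 with inverse x x≢0
  ... | x⁻¹ , xx⁻¹≡1 = mk↔ₛ′ (x ·_) (x⁻¹ ·_) (cancel x x⁻¹ xx⁻¹≡1) (cancel x⁻¹ x (trans (*-comm x⁻¹ x) xx⁻¹≡1))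
    where
    cancel : ∀ a b → a · b ≡ 1# → ∀ y → a · (b · y) ≡ y
    cancel a b ab≡1 y = trans (sym (*-assoc a b y)) (trans (cong (_· y) ab≡1) (*-identityˡ y))

  power-↔ : ∀ j κ → (∀ x → x ^ᶠ (j ℕ.* κ) ≡ x) → Carrier ↔ Carrier
  power-↔ j κ x^jκ≡x = mk↔ₛ′ (_^ᶠ j) (_^ᶠ κ)
    (λ y → trans (sym (^ᶠ-* y κ j)) (trans (cong (y ^ᶠ_) (ℕ.*-comm κ j)) (x^jκ≡x y)))
    (λ x → trans (sym (^ᶠ-* x j κ)) (x^jκ≡x x))

  ≅-relabel : ∀ {m₁ n₁ m₂ n₂} (σ : Carrier ↔ Carrier) →
    (∀ x → Inverse.to σ x ^ᶠ m₂ ≡ x ^ᶠ m₁) → (∀ x → Inverse.to σ x ^ᶠ n₂ ≡ x ^ᶠ n₁) →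
    D F m₁ n₁ ≅ D F m₂ n₂
  ≅-relabel σ σᵐ σⁿ = ↔⇒⤖ (σ ×-↔ ↔-id Carrier) , λ (x₁ , _) (y₁ , _) →
    let monomials = cong₂ _·_ (σᵐ x₁) (σⁿ y₁)
    in mk⇔ (λ arc → trans arc (sym monomials)) (λ arc → trans arc monomials)

  ≅-power : ∀ {m₁ n₁ m₂ n₂} j κ → (∀ x → x ^ᶠ (j ℕ.* κ) ≡ x) →
    (∀ x → x ^ᶠ (j ℕ.* m₂) ≡ x ^ᶠ m₁) → (∀ x → x ^ᶠ (j ℕ.* n₂) ≡ x ^ᶠ n₁) →
    D F m₁ n₁ ≅ D F m₂ n₂
  ≅-power {m₁} {n₁} {m₂} {n₂} j κ x^jκ≡x x^jm₂≡x^m₁ x^jn₂≡x^n₁ =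
    ≅-relabel {m₁} {n₁} {m₂} {n₂} (power-↔ j κ x^jκ≡x)
    (λ x → trans (sym (^ᶠ-* x j m₂)) (x^jm₂≡x^m₁ x))
    (λ x → trans (sym (^ᶠ-* x j n₂)) (x^jn₂≡x^n₁ x))

module Fermat {M : ℕ} (F : FiniteField (suc M)) where

  open FiniteField F
    using (Carrier; 0#; 1#; 0≢1; enum; isCommutativeRing)
    renaming (_*_ to _·_; _^_ to _^ᶠ_)
  open IsCommutativeRing isCommutativeRing using (*-identityˡ; *-identityʳ; zeroˡ; zeroʳ)
  open Properties F

  *-commutativeMonoid : CommutativeMonoid _ _
  *-commutativeMonoid = CommutativeRing.*-commutativeMonoid (record { isCommutativeRing = isCommutativeRing })

  open import Algebra.Properties.CommutativeMonoid.Sum *-commutativeMonoid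
    using (sum-cong-≗; sum-permute; sum-remove; ∑-distrib-+) renaming (sum to product)

  E : Carrier ↔ Fin (suc M)
  E = ⤖⇒↔ enum

  ∏ : (Carrier → Carrier) → Carrier
  ∏ f = product (f ∘ Inverse.from E)

  ∏-cong : ∀ {f g} → (∀ y → f y ≡ g y) → ∏ f ≡ ∏ g
  ∏-cong f≗g = sum-cong-≗ (f≗g ∘ Inverse.from E)

  ∏-distrib : ∀ f g → ∏ (λ y → f y · g y) ≡ ∏ f · ∏ g
  ∏-distrib f g = ∑-distrib-+ (f ∘ Inverse.from E) (g ∘ Inverse.from E)

  ∏-permute : ∀ f (σ : Carrier ↔ Carrier) → ∏ f ≡ ∏ (f ∘ Inverse.to σ)
  ∏-permute f σ = trans (sum-permute (f ∘ Inverse.from E) (E ↔-∘ (σ ↔-∘ ↔-sym E)))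
    (sum-cong-≗ (λ i → cong f (Inverse.strictlyInverseʳ E (Inverse.to σ (Inverse.from E i)))))

  product-nonzero : ∀ {n} (t : Vector Carrier n) → (∀ i → t i ≢ 0#) → product t ≢ 0#
  product-nonzero {zero}  t t≢0 = 0≢1 ∘ sym
  product-nonzero {suc n} t t≢0 = ·-nonzero (t≢0 Fin.zero) (product-nonzero (t ∘ Fin.suc) (t≢0 ∘ Fin.suc))

  product-const : ∀ n x → product {n} (λ _ → x) ≡ x ^ᶠ n
  product-const zero    x = refl
  product-const (suc n) x = cong (x ·_) (product-const n x)

  ∏-punctured : ∀ f x → f 0# ≡ 1# → (∀ y → y ≢ 0# → f y ≡ x) → ∏ f ≡ x ^ᶠ M
  ∏-punctured f x f0≡1 f≡x = begin
    ∏ f                                          ≡⟨ sum-remove {i = i₀} (f ∘ Inverse.from E) ⟩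
    f (Inverse.from E i₀) · product (λ j → f (Inverse.from E (Fin.punchIn i₀ j)))
      ≡⟨ cong₂ _·_ (trans (cong f (Inverse.strictlyInverseʳ E 0#)) f0≡1) (sum-cong-≗ off-zero) ⟩
    1# · product {M} (λ _ → x)                   ≡⟨ *-identityˡ _ ⟩
    product {M} (λ _ → x)                        ≡⟨ product-const M x ⟩
    x ^ᶠ M                                       ∎
    where
    open ≡-Reasoning
    i₀ = Inverse.to E 0#
    off-zero : ∀ j → f (Inverse.from E (Fin.punchIn i₀ j)) ≡ x
    off-zero j = f≡x _ λ y≡0 → punchInᵢ≢i i₀ j
      (trans (sym (Inverse.strictlyInverseˡ E _)) (cong (Inverse.to E) y≡0))

  unless-zero : Carrier → Carrier → Carrier
  unless-zero y v = if does (y ≟ 0#) then 1# else v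

  unless-zero-0# : ∀ v → unless-zero 0# v ≡ 1#
  unless-zero-0# v = cong (λ b → if b then 1# else v) (dec-true (0# ≟ 0#) refl)

  unless-zero-≢0# : ∀ {v} y → y ≢ 0# → unless-zero y v ≡ v
  unless-zero-≢0# {v} y y≢0 = cong (λ b → if b then 1# else v) (dec-false (y ≟ 0#) y≢0)

  unless-zero-nonzero : ∀ y → unless-zero y y ≢ 0#
  unless-zero-nonzero y with y ≟ 0#
  ... | yes refl = λ 1≡0 → 0≢1 (trans (sym 1≡0) (unless-zero-0# 0#))
  ... | no y≢0   = λ y≡0 → y≢0 (trans (sym (unless-zero-≢0# {y} y y≢0)) y≡0)

  unless-zero-scale : ∀ {x} → x ≢ 0# → ∀ y →
    unless-zero (x · y) (x · y) ≡ unless-zero y x · unless-zero y y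
  unless-zero-scale {x} x≢0 y with y ≟ 0#
  ... | yes refl = begin
    unless-zero (x · 0#) (x · 0#)          ≡⟨ cong (λ z → unless-zero z z) (zeroʳ x) ⟩
    unless-zero 0# 0#                      ≡⟨ unless-zero-0# 0# ⟩
    1#                                     ≡⟨ *-identityˡ 1# ⟨
    1# · 1#                                ≡⟨ cong₂ _·_ (unless-zero-0# x) (unless-zero-0# 0#) ⟨
    unless-zero 0# x · unless-zero 0# 0#   ∎
    where open ≡-Reasoning
  ... | no y≢0   = trans (unless-zero-≢0# (x · y) (·-nonzero x≢0 y≢0))
    (sym (cong₂ _·_ (unless-zero-≢0# y y≢0) (unless-zero-≢0# y y≢0)))

  -- Multiplication by x permutes the field, and ν (x y) = ξ y · ν y, so
  -- ∏ ν = ∏ ξ · ∏ ν = x ^ M · ∏ ν, where ∏ ν ≠ 0 because ν replaces 0 by 1.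
  fermat : ∀ {x} → x ≢ 0# → x ^ᶠ M ≡ 1#
  fermat {x} x≢0 = ·-cancelʳ (product-nonzero _ (unless-zero-nonzero ∘ Inverse.from E)) (begin
    x ^ᶠ M · ∏ ν                            ≡⟨ cong (_· ∏ ν) (∏-punctured ξ x (unless-zero-0# x) unless-zero-≢0#) ⟨
    ∏ ξ · ∏ ν                                ≡⟨ ∏-distrib ξ ν ⟨
    ∏ (λ y → ξ y · ν y)                      ≡⟨ ∏-cong (unless-zero-scale x≢0) ⟨
    ∏ (ν ∘ (x ·_))                           ≡⟨ ∏-permute ν (scale-↔ x≢0) ⟨
    ∏ ν                                      ≡⟨ *-identityˡ (∏ ν) ⟨
    1# · ∏ ν                                 ∎)
    where
    open ≡-Reasoning
    ξ ν : Carrier → Carrier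
    ξ y = unless-zero y x
    ν y = unless-zero y y

  module _ .{{_ : NonZero M}} where

    ^ᶠ-%-reduce : ∀ {x} → x ≢ 0# → ∀ a → x ^ᶠ a ≡ x ^ᶠ (a ℕ.% M)
    ^ᶠ-%-reduce {x} x≢0 a = begin
      x ^ᶠ a                                 ≡⟨ cong (x ^ᶠ_) (ℕ.m≡m%n+[m/n]*n a M) ⟩
      x ^ᶠ (a ℕ.% M ℕ.+ a ℕ./ M ℕ.* M)      ≡⟨ cong (λ e → x ^ᶠ (a ℕ.% M ℕ.+ e)) (ℕ.*-comm (a ℕ./ M) M) ⟩
      x ^ᶠ (a ℕ.% M ℕ.+ M ℕ.* (a ℕ./ M))    ≡⟨ ^ᶠ-+ x (a ℕ.% M) (M ℕ.* (a ℕ./ M)) ⟩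
      x ^ᶠ (a ℕ.% M) · x ^ᶠ (M ℕ.* (a ℕ./ M)) ≡⟨ cong (x ^ᶠ (a ℕ.% M) ·_) (^ᶠ-* x M (a ℕ./ M)) ⟩
      x ^ᶠ (a ℕ.% M) · (x ^ᶠ M) ^ᶠ (a ℕ./ M) ≡⟨ cong (λ y → x ^ᶠ (a ℕ.% M) · y ^ᶠ (a ℕ./ M)) (fermat x≢0) ⟩
      x ^ᶠ (a ℕ.% M) · 1# ^ᶠ (a ℕ./ M)      ≡⟨ cong (x ^ᶠ (a ℕ.% M) ·_) (1^ᶠ (a ℕ./ M)) ⟩
      x ^ᶠ (a ℕ.% M) · 1#                   ≡⟨ *-identityʳ _ ⟩
      x ^ᶠ (a ℕ.% M)                        ∎
      where open ≡-Reasoning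

    ^ᶠ-cong-% : ∀ x {a b} → 1 ≤ a → 1 ≤ b → a ℕ.% M ≡ b ℕ.% M → x ^ᶠ a ≡ x ^ᶠ b
    ^ᶠ-cong-% x (s≤s _) (s≤s _) a≡b with x ≟ 0#
    ... | yes refl = trans (zeroˡ _) (sym (zeroˡ _))
    ... | no x≢0   = trans (^ᶠ-%-reduce x≢0 _) (trans (cong (x ^ᶠ_) a≡b) (sym (^ᶠ-%-reduce x≢0 _)))

theorem5 : (q : ℕ) → (Σ ℕ λ p → Σ ℕ λ e → Prime p × 1 ≤ e × q ≡ p ^ e) →
    (F : FiniteField q) → (m₁ n₁ m₂ n₂ : ℕ) →
    1 ≤ m₁ → m₁ ≤ q ∸ 1 → 1 ≤ n₁ → n₁ ≤ q ∸ 1 →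
    1 ≤ m₂ → m₂ ≤ q ∸ 1 → 1 ≤ n₂ → n₂ ≤ q ∸ 1 →
    (Σ ℤ λ k → gcd k (+ (q ∸ 1)) ≡ + 1 ×
        (+ (q ∸ 1)) ∣ (+ m₂ - k * + m₁) × (+ (q ∸ 1)) ∣ (+ n₂ - k * + n₁)) →
    D F m₁ n₁ ≅ D F m₂ n₂
theorem5 zero          _ _ _ _ _ _ (s≤s _) () _ _ _ _ _ _ _
theorem5 (suc zero)    _ _ _ _ _ _ (s≤s _) () _ _ _ _ _ _ _
theorem5 (suc (suc n)) _ F m₁ n₁ m₂ n₂ 1≤m₁ _ 1≤n₁ _ 1≤m₂ _ 1≤n₂ _ (k , k-coprime , m₂≡km₁ , n₂≡kn₁)
  = let j , κ , 1≤j , 1≤κ , jκ≡1 , j-inverts-k = exponent-inverse {suc n} k k-coprime in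
    ≅-power {m₁} {n₁} {m₂} {n₂} j κ
      (λ x → trans (^ᶠ-cong-% x (ℕ.*-mono-≤ 1≤j 1≤κ) ℕ.≤-refl jκ≡1) (^ᶠ-identityʳ x))
      (λ x → ^ᶠ-cong-% x (ℕ.*-mono-≤ 1≤j 1≤m₂) 1≤m₁ (j-inverts-k (mk≈ (∣ᵤ⇒∣ m₂≡km₁))))
      (λ x → ^ᶠ-cong-% x (ℕ.*-mono-≤ 1≤j 1≤n₂) 1≤n₁ (j-inverts-k (mk≈ (∣ᵤ⇒∣ n₂≡kn₁))))
  where
  open Fermat F
  open Properties F
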